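{- Let $l_1, m_1, l_2, m_2$ be positive integers with $l_1 \le m_1 < l_2 \le m_2$, and let $k$ be a positive integer. Then (a) $\displaystyle f([l_1,m_1]\cup[l_2,m_2]) = \sum_{d=1}^{m_2} \mu(d)\left(2^{\lfloor m_1/d\rfloor + \lfloor m_2/d\rfloor - \lfloor (l_1-1)/d\rfloor - \lfloor (l_2-1)/d\rfloor} - 1\right)$; (b) $\displaystyle f_k([l_1,m_1]\cup[l_2,m_2]) = \sum_{d=1}^{m_2} \mu(d) \binom{\lfloor m_1/d\rfloor + \lfloor m_2/d\rfloor - \lfloor (l_1-1)/d\rfloor - \lfloor (l_2-1)/d\rfloor}{k}$.
   Context: For positive integers $l \le m$, $[l,m] = \{l, l+1, \ldots, m\}$. For a nonempty finite set $A$ of positive integers, $f(A)$ is the number of nonempty subsets $X \subseteq A$ with $\gcd(X) = 1$, and $f_k(A)$ is the number of subsets $X \subseteq A$ with $\#X = k$ and $\gcd(X)=1$. $\mu$ is the Möbius function and $\lfloor x\rfloor$ the floor of $x$. -}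

module Defs where

open import Data.Nat using (ℕ; zero; suc; _+_; _*_; _∸_; _^_; _/_; _≟_)
open import Data.Nat.Divisibility using (_∣?_)
open import Data.Nat.GCD using (gcd)
open import Data.Nat.Primality using (prime?)
open import Data.Nat.Combinatorics using (_C_)
open import Data.List using (List; []; _∷_; _++_; map; filter; length; upTo; foldr)
open import Data.Integer using (ℤ; +_; -_)
import Data.Integer as ℤ
open import Relation.Nullary.Decidable using (¬?; _×-dec_)

-- [l, m] = {l, l+1, ..., m} as a list (empty if m < l)
range : ℕ → ℕ → List ℕ
range l m = Data.List.map (λ i → l + i) (upTo (suc m ∸ l))

-- all sublists (= all subsets, as the list has distinct entries)
subsets : {A : Set} → List A → List (List A)
subsets []       = [] ∷ []
subsets (x ∷ xs) = subsets xs ++ map (x ∷_) (subsets xs)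

-- gcd of a finite set (gcd of empty list is 0)
gcdL : List ℕ → ℕ
gcdL = foldr gcd 0

-- f(A): number of nonempty subsets X ⊆ A with gcd(X) = 1
-- (the empty set has gcd 0, so it is automatically excluded)
f : List ℕ → ℕ
f A = length (filter (λ X → gcdL X ≟ 1) (subsets A))

fk : ℕ → List ℕ → ℕ
fk k A = length (filter (λ X → (gcdL X ≟ 1) ×-dec (length X ≟ k)) (subsets A))

-- Möbius function: μ(d) = 0 if p² ∣ d for some prime p,
-- otherwise (-1)^(number of distinct prime divisors of d); μ(1) = 1.
-- (μ 0 is irrelevant, set to 0.)
primeDivisors : ℕ → List ℕ
primeDivisors d = filter (λ p → prime? p ×-dec (p ∣? d)) (upTo (suc d))

μ : ℕ → ℤ
μ zero = + 0
μ d@(suc _) with length (filter (λ p → (p * p) ∣? d) (primeDivisors d))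
... | zero  = (- + 1) ℤ.^ length (primeDivisors d)
... | suc _ = + 0

sumFrom1 : ℕ → (ℕ → ℤ) → ℤ
sumFrom1 zero    g = + 0
sumFrom1 (suc n) g = sumFrom1 n g ℤ.+ g (suc n)

-- exponent ⌊m1/d⌋ + ⌊m2/d⌋ - ⌊(l1-1)/d⌋ - ⌊(l2-1)/d⌋ for d ≥ 1
-- (natural subtraction is exact here since l1 ≤ m1 < l2 ≤ m2)
expo : ℕ → ℕ → ℕ → ℕ → ℕ → ℕ
expo l1 m1 l2 m2 zero = 0
expo l1 m1 l2 m2 d@(suc _) = ((m1 / d) + (m2 / d)) ∸ ((l1 ∸ 1) / d) ∸ ((l2 ∸ 1) / d)

{-# OPTIONS --safe #-}
-- Möbius inversion. For a nonempty X ⊆ [1, N], the divisor sum Σ_{d ∣ n} μ(d) = [n = 1] at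
-- n = gcd X gives [gcd X = 1] = Σ_{d ≤ N} μ(d) [d ∣ gcd X]. Summing over the nonempty (resp.
-- k-element) subsets X of A and exchanging the sums, the term of d counts the nonempty (resp.
-- k-element) subsets of the c multiples of d in A, i.e. 2^c − 1 (resp. c choose k); for
-- A = [l₁, m₁] ∪ [l₂, m₂] one has c = ⌊m₁/d⌋ − ⌊(l₁−1)/d⌋ + ⌊m₂/d⌋ − ⌊(l₂−1)/d⌋.
module Submission where

open import Defs
open import Data.Nat using (ℕ; _≤_; _<_; _^_; _∸_)
open import Data.Nat.Combinatorics using (_C_)
open import Data.List using (_++_)
open import Data.Integer using (ℤ; +_)
import Data.Integer as ℤ
open import Data.Product using (_×_)
open import Relation.Binary.PropositionalEquality using (_≡_)

open import Data.Integer using (0ℤ; -1ℤ; -_)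
import Data.Integer.Properties as ℤP
open import Data.Integer.Tactic.RingSolver using (solve-∀)
open import Data.Nat
  using (zero; suc; _+_; _*_; _/_; _≟_; _<?_; z≤n; s≤s; NonZero; NonTrivial; ≢-nonZero; nonTrivial⇒≢1; nonTrivial⇒nonZero)
open import Data.Nat.Properties
import Data.Nat.Tactic.RingSolver as ℕ-Solver
open import Data.Nat.Combinatorics using (nCk+nC[k+1]≡[n+1]C[k+1])
open import Data.Nat.Divisibility
  using (_∣_; _∣?_; divides; _∣0; ∣⇒≤; ∣-trans; m∣m*n; n∣m*n; m*n∣⇒m∣; *-cancelʳ-∣; *-monoˡ-∣; n∣m⇒m%n≡0)
open import Data.Nat.DivMod
  using (_%_; m≡m%n+[m/n]*n; m%n<n; %-congˡ; [m+kn]%n≡m%n; m<n⇒m%n≡m; /-congˡ; +-distrib-/-∣ʳ; m<n⇒m/n≡0; m*n/n≡m)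
open import Data.Nat.GCD using (gcd; gcd[m,n]∣m; gcd[m,n]∣n; gcd-greatest; gcd[m,n]≢0)
open import Data.Nat.Coprimality using (Coprime; coprime-divisor) renaming (sym to coprime-sym)
open import Data.Nat.Primality
  using (Prime; prime?; euclidsLemma; prime⇒irreducible; prime⇒nonZero; prime⇒nonTrivial)
open import Data.Nat.Primality.Factorisation using (factorise)
open import Data.List using (List; []; _∷_; map; filter; length; upTo; applyUpTo)
open import Data.List.Properties
  using (length-++; length-map; filter-++; filter-none; filter-all; filter-≐; filter-some; applyUpTo-∷ʳ)
open import Data.List.Membership.Propositional using (lose)
open import Data.List.Membership.Propositional.Properties using (∈-upTo⁺)
open import Data.List.Relation.Unary.All as All using (All; []; _∷_)
open import Data.List.Relation.Unary.All.Properties using (++⁺; map⁺; all-upTo)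
open import Data.Product using (∃-syntax; _,_; proj₁; proj₂)
open import Data.Sum using (inj₁; inj₂)
open import Function using (_∘_; id)
open import Relation.Binary.PropositionalEquality using (refl; sym; trans; cong; cong₂; subst; module ≡-Reasoning)
open import Relation.Nullary using (Dec; yes; no; ¬_; contradiction)
open import Relation.Nullary.Decidable using (_×-dec_; ¬?)
open import Relation.Unary using (Decidable; _≐_)

open ≡-Reasoning

-- Indicators and counting

𝟙 : {A : Set} → Dec A → ℕ
𝟙 (yes _) = 1
𝟙 (no _)  = 0

𝟙-yes : {A : Set} (a? : Dec A) → A → 𝟙 a? ≡ 1
𝟙-yes (yes _) _ = refl
𝟙-yes (no ¬a) a = contradiction a ¬a

𝟙-no : {A : Set} (a? : Dec A) → ¬ A → 𝟙 a? ≡ 0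
𝟙-no (yes a) ¬a = contradiction a ¬a
𝟙-no (no _)  _  = refl

𝟙-⇔ : {A B : Set} (a? : Dec A) (b? : Dec B) → (A → B) → (B → A) → 𝟙 a? ≡ 𝟙 b?
𝟙-⇔ (yes _) (yes _) _ _ = refl
𝟙-⇔ (yes a) (no ¬b) f _ = contradiction (f a) ¬b
𝟙-⇔ (no ¬a) (yes b) _ g = contradiction (g b) ¬a
𝟙-⇔ (no _)  (no _)  _ _ = refl

𝟙-×-yesʳ : {A B : Set} (a? : Dec A) (b : B) → 𝟙 (a? ×-dec yes b) ≡ 𝟙 a?
𝟙-×-yesʳ (yes _) _ = refl
𝟙-×-yesʳ (no _)  _ = refl

𝟙-×-noʳ : {A B : Set} (a? : Dec A) (¬b : ¬ B) → 𝟙 (a? ×-dec no ¬b) ≡ 0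
𝟙-×-noʳ (yes _) _ = refl
𝟙-×-noʳ (no _)  _ = refl

count : {A : Set} {P : A → Set} → Decidable P → List A → ℕ
count P? xs = length (filter P? xs)

module _ {A : Set} {P : A → Set} (P? : Decidable P) where

  count-∷ : ∀ x xs → count P? (x ∷ xs) ≡ 𝟙 (P? x) + count P? xs
  count-∷ x xs with P? x
  ... | yes _ = refl
  ... | no  _ = refl

  count-++ : ∀ xs ys → count P? (xs ++ ys) ≡ count P? xs + count P? ys
  count-++ xs ys = trans (cong length (filter-++ P? xs ys)) (length-++ (filter P? xs))

  count-none : ∀ {xs} → All (¬_ ∘ P) xs → count P? xs ≡ 0
  count-none ¬Ps = cong length (filter-none P? ¬Ps)

  count-all : ∀ {xs} → All P xs → count P? xs ≡ length xs
  count-all Ps = cong length (filter-all P? Ps)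

  count-applyUpTo-suc : ∀ (f : ℕ → A) n →
    count P? (applyUpTo f (suc n)) ≡ count P? (applyUpTo f n) + 𝟙 (P? (f n))
  count-applyUpTo-suc f n = begin
    count P? (applyUpTo f (suc n))                  ≡⟨ cong (count P?) (applyUpTo-∷ʳ f n) ⟨
    count P? (applyUpTo f n ++ f n ∷ [])            ≡⟨ count-++ (applyUpTo f n) (f n ∷ []) ⟩
    count P? (applyUpTo f n) + count P? (f n ∷ [])  ≡⟨ cong (_+_ (count P? (applyUpTo f n))) last ⟩
    count P? (applyUpTo f n) + 𝟙 (P? (f n))         ∎
    where
    last : count P? (f n ∷ []) ≡ 𝟙 (P? (f n))
    last = trans (count-∷ (f n) []) (+-identityʳ _)

count-map : {A B : Set} {P : B → Set} (P? : Decidable P) (f : A → B) (xs : List A) →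
  count P? (map f xs) ≡ count (P? ∘ f) xs
count-map P? f []       = refl
count-map P? f (x ∷ xs) = begin
  count P? (f x ∷ map f xs)           ≡⟨ count-∷ P? (f x) (map f xs) ⟩
  𝟙 (P? (f x)) + count P? (map f xs)  ≡⟨ cong (_+_ (𝟙 (P? (f x)))) (count-map P? f xs) ⟩
  𝟙 (P? (f x)) + count (P? ∘ f) xs    ≡⟨ count-∷ (P? ∘ f) x xs ⟨
  count (P? ∘ f) (x ∷ xs)             ∎

module _ {A : Set} {P Q : A → Set} (P? : Decidable P) (Q? : Decidable Q) where

  count-≐ : P ≐ Q → ∀ xs → count P? xs ≡ count Q? xs
  count-≐ P≐Q xs = cong length (filter-≐ P? Q? P≐Q xs)

  count-filter : ∀ xs → count Q? (filter P? xs) ≡ count (λ x → P? x ×-dec Q? x) xs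
  count-filter []       = refl
  count-filter (x ∷ xs) with P? x
  ... | no _ = count-filter xs
  ... | yes _ with Q? x
  ...   | yes _ = cong suc (count-filter xs)
  ...   | no _  = count-filter xs

  count-+ : {R : A → Set} (R? : Decidable R) → (∀ x → 𝟙 (P? x) ≡ 𝟙 (Q? x) + 𝟙 (R? x)) →
            ∀ xs → count P? xs ≡ count Q? xs + count R? xs
  count-+ R? split []       = refl
  count-+ R? split (x ∷ xs) = begin
    count P? (x ∷ xs)                                    ≡⟨ count-∷ P? x xs ⟩
    𝟙 (P? x) + count P? xs                               ≡⟨ cong₂ _+_ (split x) (count-+ R? split xs) ⟩
    (𝟙 (Q? x) + 𝟙 (R? x)) + (count Q? xs + count R? xs)  ≡⟨ +-+-interchange (𝟙 (Q? x)) (𝟙 (R? x)) _ _ ⟩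
    (𝟙 (Q? x) + count Q? xs) + (𝟙 (R? x) + count R? xs)  ≡⟨ cong₂ _+_ (count-∷ Q? x xs) (count-∷ R? x xs) ⟨
    count Q? (x ∷ xs) + count R? (x ∷ xs)                ∎
    where
    +-+-interchange : ∀ a b c d → (a + b) + (c + d) ≡ (a + c) + (b + d)
    +-+-interchange = ℕ-Solver.solve-∀

module _ {P : ℕ → Set} (P? : Decidable P) where

  count-upTo-stable : ∀ {m} → (∀ q → P q → q < m) →
                      ∀ n → m ≤ n → count P? (upTo n) ≡ count P? (upTo m)
  count-upTo-stable bound zero    z≤n = refl
  count-upTo-stable {m} bound (suc n) m≤1+n with m≤n⇒m<n∨m≡n m≤1+n
  ... | inj₂ refl  = refl
  ... | inj₁ m<1+n = begin
    count P? (upTo (suc n))       ≡⟨ count-applyUpTo-suc P? id n ⟩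
    count P? (upTo n) + 𝟙 (P? n)  ≡⟨ cong₂ _+_ (count-upTo-stable bound n m≤n) (𝟙-no (P? n) ¬Pn) ⟩
    count P? (upTo m) + 0         ≡⟨ +-identityʳ _ ⟩
    count P? (upTo m)             ∎
    where
    m≤n = ≤-pred m<1+n
    ¬Pn : ¬ P n
    ¬Pn Pn = <⇒≱ (bound n Pn) m≤n

  count-upTo-pos : ∀ {q n} → q < n → P q → 1 ≤ count P? (upTo n)
  count-upTo-pos q<n Pq = filter-some P? (lose (∈-upTo⁺ q<n) Pq)

count-upTo-≟ : ∀ {p n} → p < n → count (_≟ p) (upTo n) ≡ 1
count-upTo-≟ {p} {n} p<n = begin
  count (_≟ p) (upTo n)              ≡⟨ count-upTo-stable (_≟ p) (λ { q refl → ≤-refl }) n p<n ⟩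
  count (_≟ p) (upTo (suc p))        ≡⟨ count-applyUpTo-suc (_≟ p) id p ⟩
  count (_≟ p) (upTo p) + 𝟙 (p ≟ p)  ≡⟨ cong₂ _+_ below-p (𝟙-yes (p ≟ p) refl) ⟩
  1                                  ∎
  where
  below-p : count (_≟ p) (upTo p) ≡ 0
  below-p = count-none (_≟ p) (All.map (λ q<p q≡p → <-irrefl q≡p q<p) (all-upTo p))

-- Sums over [1, n]

sumFrom1-cong : ∀ {g h} n → (∀ d .{{_ : NonZero d}} → g d ≡ h d) → sumFrom1 n g ≡ sumFrom1 n h
sumFrom1-cong zero    g≡h = refl
sumFrom1-cong (suc n) g≡h = cong₂ ℤ._+_ (sumFrom1-cong n g≡h) (g≡h (suc n))

sumFrom1-zero : ∀ n → sumFrom1 n (λ _ → 0ℤ) ≡ 0ℤ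
sumFrom1-zero zero    = refl
sumFrom1-zero (suc n) = trans (ℤP.+-identityʳ _) (sumFrom1-zero n)

sumFrom1-+ : ∀ n g h → sumFrom1 n (λ d → g d ℤ.+ h d) ≡ sumFrom1 n g ℤ.+ sumFrom1 n h
sumFrom1-+ zero    g h = refl
sumFrom1-+ (suc n) g h = trans (cong (ℤ._+ (g (suc n) ℤ.+ h (suc n))) (sumFrom1-+ n g h))
                               (interchange (sumFrom1 n g) (sumFrom1 n h) (g (suc n)) (h (suc n)))
  where
  interchange : ∀ a b c d → (a ℤ.+ b) ℤ.+ (c ℤ.+ d) ≡ (a ℤ.+ c) ℤ.+ (b ℤ.+ d)
  interchange = solve-∀

sumFrom1-neg : ∀ n g → sumFrom1 n (λ d → - g d) ≡ - sumFrom1 n g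
sumFrom1-neg zero    g = refl
sumFrom1-neg (suc n) g = trans (cong (ℤ._+ (- g (suc n))) (sumFrom1-neg n g))
                               (sym (ℤP.neg-distrib-+ (sumFrom1 n g) (g (suc n))))

sumFrom1-stable : ∀ {g m} n → m ≤ n → (∀ d → m < d → d ≤ n → g d ≡ 0ℤ) →
                  sumFrom1 n g ≡ sumFrom1 m g
sumFrom1-stable zero    z≤n   vanish = refl
sumFrom1-stable {g} {m} (suc n) m≤1+n vanish with m≤n⇒m<n∨m≡n m≤1+n
... | inj₂ refl  = refl
... | inj₁ m<1+n = begin
  sumFrom1 n g ℤ.+ g (suc n)  ≡⟨ cong₂ ℤ._+_ (sumFrom1-stable n (≤-pred m<1+n) vanish′) (vanish (suc n) m<1+n ≤-refl) ⟩
  sumFrom1 m g ℤ.+ 0ℤ         ≡⟨ ℤP.+-identityʳ _ ⟩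
  sumFrom1 m g                ∎
  where
  vanish′ : ∀ d → m < d → d ≤ n → g d ≡ 0ℤ
  vanish′ d m<d d≤n = vanish d m<d (m≤n⇒m≤1+n d≤n)

when : {A : Set} → Dec A → ℤ → ℤ
when (yes _) z = z
when (no _)  _ = 0ℤ

when-yes : {A : Set} (a? : Dec A) {z : ℤ} → A → when a? z ≡ z
when-yes (yes _) _ = refl
when-yes (no ¬a) a = contradiction a ¬a

when-⇔ : {A B : Set} (a? : Dec A) (b? : Dec B) {z : ℤ} →
         (A → B) → (B → A) → when a? z ≡ when b? z
when-⇔ (yes _) (yes _) _ _ = refl
when-⇔ (yes a) (no ¬b) f _ = contradiction (f a) ¬b
when-⇔ (no ¬a) (yes b) _ g = contradiction (g b) ¬a
when-⇔ (no _)  (no _)  _ _ = refl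

*-𝟙 : {A : Set} (a? : Dec A) (z : ℤ) → z ℤ.* + 𝟙 a? ≡ when a? z
*-𝟙 (yes _) z = ℤP.*-identityʳ z
*-𝟙 (no _)  z = ℤP.*-zeroʳ z

∤-between-multiples : ∀ {m K d} → K * m < d → d < suc K * m → ¬ m ∣ d
∤-between-multiples {m} {K} Km<cm cm<[1+K]m (divides c refl) =
  <⇒≱ (*-cancelʳ-< m K c Km<cm) (≤-pred (*-cancelʳ-< m c (suc K) cm<[1+K]m))

sumFrom1-multiples : ∀ m .{{_ : NonZero m}} K (g : ℕ → ℤ) →
  sumFrom1 (K * m) (λ d → when (m ∣? d) (g d)) ≡ sumFrom1 K (λ e → g (e * m))
sumFrom1-multiples m       zero    g = refl
sumFrom1-multiples m@(suc q) (suc K) g = begin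
  sumFrom1 (q + K * m) φ ℤ.+ φ (suc K * m)
    ≡⟨ cong₂ ℤ._+_ (sumFrom1-stable (q + K * m) (m≤n+m (K * m) q) gap) (when-yes (m ∣? suc K * m) (n∣m*n (suc K))) ⟩
  sumFrom1 (K * m) φ ℤ.+ g (suc K * m)
    ≡⟨ cong (ℤ._+ g (suc K * m)) (sumFrom1-multiples m K g) ⟩
  sumFrom1 K (λ e → g (e * m)) ℤ.+ g (suc K * m)
    ∎
  where
  φ : ℕ → ℤ
  φ d = when (m ∣? d) (g d)
  gap : ∀ d → K * m < d → d ≤ q + K * m → φ d ≡ 0ℤ
  gap d Km<d d≤q+Km with m ∣? d
  ... | yes m∣d = contradiction m∣d (∤-between-multiples {K = K} Km<d (s≤s d≤q+Km))
  ... | no  _   = refl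

-- The Möbius function

sign : ℕ → ℕ → ℤ
sign zero    ω = -1ℤ ℤ.^ ω
sign (suc _) _ = 0ℤ

sign-suc : ∀ s ω → sign s (suc ω) ≡ - sign s ω
sign-suc zero    ω = ℤP.-1*i≡-i (-1ℤ ℤ.^ ω)
sign-suc (suc s) ω = refl

primeDivisor? : ∀ n → Decidable (λ p → Prime p × p ∣ n)
primeDivisor? n p = prime? p ×-dec p ∣? n

primeSquareDivisor? : ∀ n → Decidable (λ p → Prime p × p * p ∣ n)
primeSquareDivisor? n p = prime? p ×-dec p * p ∣? n

primeDivisorCount primeSquareDivisorCount : ℕ → ℕ
primeDivisorCount       n = count (primeDivisor? n) (upTo (suc n))
primeSquareDivisorCount n = count (primeSquareDivisor? n) (upTo (suc n))

μ≡sign : ∀ n .{{_ : NonZero n}} → μ n ≡ sign (primeSquareDivisorCount n) (primeDivisorCount n)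
μ≡sign n@(suc _) = begin
  μ n
    ≡⟨ μ-unfold ⟩
  sign (count (λ p → p * p ∣? n) (primeDivisors n)) (primeDivisorCount n)
    ≡⟨ cong (λ s → sign s (primeDivisorCount n)) square-count ⟩
  sign (primeSquareDivisorCount n) (primeDivisorCount n)
    ∎
  where
  μ-unfold : μ n ≡ sign (count (λ p → p * p ∣? n) (primeDivisors n)) (length (primeDivisors n))
  μ-unfold with length (filter (λ p → (p * p) ∣? n) (primeDivisors n))
  ... | zero  = refl
  ... | suc _ = refl
  squares : (λ p → (Prime p × p ∣ n) × p * p ∣ n) ≐ (λ p → Prime p × p * p ∣ n)
  squares = (λ ((p-prime , _) , p²∣n) → p-prime , p²∣n)
          , (λ {p} (p-prime , p²∣n) → (p-prime , m*n∣⇒m∣ p p p²∣n) , p²∣n)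
  square-count : count (λ p → p * p ∣? n) (primeDivisors n) ≡ primeSquareDivisorCount n
  square-count = trans (count-filter (primeDivisor? n) (λ p → p * p ∣? n) (upTo (suc n)))
                       (count-≐ (λ p → primeDivisor? n p ×-dec p * p ∣? n) (primeSquareDivisor? n) squares (upTo (suc n)))

sign-pos : ∀ {s} ω → 1 ≤ s → sign s ω ≡ 0ℤ
sign-pos ω (s≤s _) = refl

μ-squareful : ∀ {p n} .{{_ : NonZero n}} → Prime p → p * p ∣ n → μ n ≡ 0ℤ
μ-squareful {p} {n} p-prime p²∣n = trans (μ≡sign n) (sign-pos (primeDivisorCount n)
  (count-upTo-pos (primeSquareDivisor? n) (s≤s (∣⇒≤ (m*n∣⇒m∣ p p p²∣n))) (p-prime , p²∣n)))

prime∣prime⇒≡ : ∀ {p q} → Prime p → Prime q → p ∣ q → p ≡ q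
prime∣prime⇒≡ p-prime q-prime p∣q with prime⇒irreducible q-prime p∣q
... | inj₁ p≡1 = contradiction p≡1 (nonTrivial⇒≢1 {{prime⇒nonTrivial p-prime}})
... | inj₂ p≡q = p≡q

prime∤⇒coprime : ∀ {p n} → Prime p → ¬ p ∣ n → Coprime p n
prime∤⇒coprime p-prime p∤n (i∣p , i∣n) with prime⇒irreducible p-prime i∣p
... | inj₁ i≡1  = i≡1
... | inj₂ refl = contradiction i∣n p∤n

module _ {p d} (p-prime : Prime p) (p∤d : ¬ p ∣ d) where
  private instance
    p≢0 : NonZero p
    p≢0 = prime⇒nonZero p-prime

  primeDivisor-*prime : ∀ q → 𝟙 (primeDivisor? (d * p) q) ≡ 𝟙 (primeDivisor? d q) + 𝟙 (q ≟ p)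
  primeDivisor-*prime q with q ≟ p
  ... | yes refl = trans (𝟙-yes (primeDivisor? (d * p) q) (p-prime , n∣m*n d))
                         (cong (λ c → c + 1) (sym (𝟙-no (primeDivisor? d q) (p∤d ∘ proj₂))))
  ... | no  q≢p  = trans (𝟙-⇔ (primeDivisor? (d * p) q) (primeDivisor? d q)
                               (λ (q-prime , q∣dp) → q-prime , ∣d q-prime q∣dp)
                               (λ (q-prime , q∣d) → q-prime , ∣-trans q∣d (m∣m*n p)))
                         (sym (+-identityʳ _))
    where
    ∣d : Prime q → q ∣ d * p → q ∣ d
    ∣d q-prime q∣dp with euclidsLemma d p q-prime q∣dp
    ... | inj₁ q∣d = q∣d
    ... | inj₂ q∣p = contradiction (prime∣prime⇒≡ q-prime p-prime q∣p) q≢p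

  primeSquareDivisor-*prime : (λ q → Prime q × q * q ∣ d * p) ≐ (λ q → Prime q × q * q ∣ d)
  primeSquareDivisor-*prime = (λ (q-prime , q²∣dp) → q-prime , ∣d q-prime q²∣dp)
                            , (λ (q-prime , q²∣d) → q-prime , ∣-trans q²∣d (m∣m*n p))
    where
    ∣d : ∀ {q} → Prime q → q * q ∣ d * p → q * q ∣ d
    ∣d {q} q-prime q²∣dp with q ≟ p
    ... | yes refl = contradiction (*-cancelʳ-∣ q q²∣dp) p∤d
    ... | no  q≢p  = coprime-divisor (coprime-sym (prime∤⇒coprime p-prime p∤q²))
                                     (subst (q * q ∣_) (*-comm d p) q²∣dp)
      where
      p∤q² : ¬ p ∣ q * q
      p∤q² p∣q² with euclidsLemma q q p-prime p∣q²
      ... | inj₁ p∣q = q≢p (sym (prime∣prime⇒≡ p-prime q-prime p∣q))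
      ... | inj₂ p∣q = q≢p (sym (prime∣prime⇒≡ p-prime q-prime p∣q))

  module _ .{{_ : NonZero d}} where

    primeDivisorCount-*prime : primeDivisorCount (d * p) ≡ suc (primeDivisorCount d)
    primeDivisorCount-*prime = begin
      count (primeDivisor? (d * p)) (upTo (suc (d * p)))
        ≡⟨ count-+ (primeDivisor? (d * p)) (primeDivisor? d) (_≟ p) primeDivisor-*prime (upTo (suc (d * p))) ⟩
      count (primeDivisor? d) (upTo (suc (d * p))) + count (_≟ p) (upTo (suc (d * p)))
        ≡⟨ cong₂ _+_ (count-upTo-stable (primeDivisor? d) (λ q (_ , q∣d) → s≤s (∣⇒≤ q∣d)) _ (s≤s (m≤m*n d p)))
                     (count-upTo-≟ (s≤s (m≤n*m p d))) ⟩
      primeDivisorCount d + 1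
        ≡⟨ +-comm _ 1 ⟩
      suc (primeDivisorCount d)
        ∎

    primeSquareDivisorCount-*prime : primeSquareDivisorCount (d * p) ≡ primeSquareDivisorCount d
    primeSquareDivisorCount-*prime = begin
      count (primeSquareDivisor? (d * p)) (upTo (suc (d * p)))
        ≡⟨ count-≐ (primeSquareDivisor? (d * p)) (primeSquareDivisor? d) primeSquareDivisor-*prime (upTo (suc (d * p))) ⟩
      count (primeSquareDivisor? d) (upTo (suc (d * p)))
        ≡⟨ count-upTo-stable (primeSquareDivisor? d) (λ q (_ , q²∣d) → s≤s (∣⇒≤ (m*n∣⇒m∣ q q q²∣d))) _ (s≤s (m≤m*n d p)) ⟩
      primeSquareDivisorCount d
        ∎

    μ-*prime : μ (d * p) ≡ - μ d
    μ-*prime = begin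
      μ (d * p)
        ≡⟨ μ≡sign (d * p) {{m*n≢0 d p}} ⟩
      sign (primeSquareDivisorCount (d * p)) (primeDivisorCount (d * p))
        ≡⟨ cong₂ sign primeSquareDivisorCount-*prime primeDivisorCount-*prime ⟩
      sign (primeSquareDivisorCount d) (suc (primeDivisorCount d))
        ≡⟨ sign-suc (primeSquareDivisorCount d) (primeDivisorCount d) ⟩
      - sign (primeSquareDivisorCount d) (primeDivisorCount d)
        ≡⟨ cong -_ (μ≡sign d) ⟨
      - μ d
        ∎

when-zero : {A : Set} (a? : Dec A) → when a? 0ℤ ≡ 0ℤ
when-zero (yes _) = refl
when-zero (no _)  = refl

when-neg : {A : Set} (a? : Dec A) (z : ℤ) → when a? (- z) ≡ - when a? z
when-neg (yes _) z = refl
when-neg (no _)  z = refl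

∃-prime-divisor : ∀ n .{{_ : NonTrivial n}} → ∃[ p ] Prime p × p ∣ n
∃-prime-divisor n with factorise n {{nonTrivial⇒nonZero n}}
... | record { factors = [] ; isFactorisation = n≡1 } = contradiction n≡1 nonTrivial⇒≢1
... | record { factors = p ∷ _ ; isFactorisation = n≡p*r ; factorsPrime = p-prime ∷ _ } =
  p , p-prime , subst (p ∣_) (sym n≡p*r) (m∣m*n _)

module _ {p} (p-prime : Prime p) (n : ℕ) .{{_ : NonZero n}} where
  private instance
    p≢0 : NonZero p
    p≢0 = prime⇒nonZero p-prime

  -- The divisors of n * p prime to p are those of n prime to p; the other divisors are the
  -- e * p with e ∣ n, and μ (e * p) is - μ e if p ∤ e and 0 if p ∣ e, so the two parts cancel.
  Σμ-divisors-*prime : sumFrom1 (n * p) (λ d → when (d ∣? n * p) (μ d)) ≡ 0ℤ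
  Σμ-divisors-*prime = begin
    sumFrom1 (n * p) φ
      ≡⟨ sumFrom1-cong (n * p) (λ d → split d) ⟩
    sumFrom1 (n * p) (λ d → when (p ∣? d) (φ d) ℤ.+ when (¬? (p ∣? d)) (φ d))
      ≡⟨ sumFrom1-+ (n * p) _ _ ⟩
    sumFrom1 (n * p) (λ d → when (p ∣? d) (φ d)) ℤ.+ sumFrom1 (n * p) (λ d → when (¬? (p ∣? d)) (φ d))
      ≡⟨ cong₂ ℤ._+_ (sumFrom1-multiples p n φ) (sumFrom1-cong (n * p) (λ d → coprime-term d)) ⟩
    sumFrom1 n (λ e → φ (e * p)) ℤ.+ sumFrom1 (n * p) ψ
      ≡⟨ cong₂ ℤ._+_ (trans (sumFrom1-cong n multiple-term) (sumFrom1-neg n ψ))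
                     (sumFrom1-stable (n * p) (m≤m*n n p) (λ d n<d _ → ψ-vanish d n<d)) ⟩
    - sumFrom1 n ψ ℤ.+ sumFrom1 n ψ
      ≡⟨ ℤP.+-inverseˡ (sumFrom1 n ψ) ⟩
    0ℤ ∎
    where
    φ ψ : ℕ → ℤ
    φ d = when (d ∣? n * p) (μ d)
    ψ e = when (¬? (p ∣? e)) (when (e ∣? n) (μ e))

    split : ∀ d → φ d ≡ when (p ∣? d) (φ d) ℤ.+ when (¬? (p ∣? d)) (φ d)
    split d with p ∣? d
    ... | yes _ = sym (ℤP.+-identityʳ _)
    ... | no  _ = sym (ℤP.+-identityˡ _)

    multiple-term : ∀ e .{{_ : NonZero e}} → φ (e * p) ≡ - ψ e
    multiple-term e with p ∣? e
    ... | yes p∣e = trans (cong (when (e * p ∣? n * p)) (μ-squareful {{m*n≢0 e p}} p-prime (*-monoˡ-∣ p p∣e)))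
                          (when-zero (e * p ∣? n * p))
    ... | no  p∤e = begin
      when (e * p ∣? n * p) (μ (e * p))  ≡⟨ cong (when (e * p ∣? n * p)) (μ-*prime p-prime p∤e) ⟩
      when (e * p ∣? n * p) (- μ e)      ≡⟨ when-⇔ (e * p ∣? n * p) (e ∣? n) (*-cancelʳ-∣ p) (*-monoˡ-∣ p) ⟩
      when (e ∣? n) (- μ e)              ≡⟨ when-neg (e ∣? n) (μ e) ⟩
      - when (e ∣? n) (μ e)              ∎

    coprime-term : ∀ d → when (¬? (p ∣? d)) (φ d) ≡ ψ d
    coprime-term d with p ∣? d
    ... | yes _   = refl
    ... | no  p∤d = when-⇔ (d ∣? n * p) (d ∣? n)
      (λ d∣np → coprime-divisor (coprime-sym (prime∤⇒coprime p-prime p∤d)) (subst (d ∣_) (*-comm n p) d∣np))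
      (λ d∣n → ∣-trans d∣n (m∣m*n p))

    ψ-vanish : ∀ d → n < d → ψ d ≡ 0ℤ
    ψ-vanish d n<d with p ∣? d
    ... | yes _ = refl
    ... | no  _ with d ∣? n
    ...   | yes d∣n = contradiction (∣⇒≤ d∣n) (<⇒≱ n<d)
    ...   | no  _   = refl

Σμ-divisors : ∀ n .{{_ : NonZero n}} → sumFrom1 n (λ d → when (d ∣? n) (μ d)) ≡ + 𝟙 (n ≟ 1)
Σμ-divisors 1 = refl
Σμ-divisors n@(suc (suc _)) with ∃-prime-divisor n
... | p , p-prime , divides m@(suc _) n≡m*p =
  subst (λ x → sumFrom1 x (λ d → when (d ∣? x) (μ d)) ≡ 0ℤ) (sym n≡m*p) (Σμ-divisors-*prime p-prime m)

Σμ-divisors-upTo : ∀ {n} N .{{_ : NonZero n}} → n ≤ N → sumFrom1 N (λ d → μ d ℤ.* + 𝟙 (d ∣? n)) ≡ + 𝟙 (n ≟ 1)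
Σμ-divisors-upTo {n} N n≤N = begin
  sumFrom1 N (λ d → μ d ℤ.* + 𝟙 (d ∣? n))  ≡⟨ sumFrom1-cong N (λ d → *-𝟙 (d ∣? n) (μ d)) ⟩
  sumFrom1 N (λ d → when (d ∣? n) (μ d))   ≡⟨ sumFrom1-stable N n≤N (λ d n<d _ → non-divisor d n<d) ⟩
  sumFrom1 n (λ d → when (d ∣? n) (μ d))   ≡⟨ Σμ-divisors n ⟩
  + 𝟙 (n ≟ 1)                              ∎
  where
  non-divisor : ∀ d → n < d → when (d ∣? n) (μ d) ≡ 0ℤ
  non-divisor d n<d with d ∣? n
  ... | yes d∣n = contradiction (∣⇒≤ d∣n) (<⇒≱ n<d)
  ... | no  _   = refl

-- Counting subsets

All-subsets : {A : Set} {P : A → Set} {xs : List A} → All P xs → All (All P) (subsets xs)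
All-subsets []         = [] ∷ []
All-subsets (px ∷ pxs) = ++⁺ (All-subsets pxs) (map⁺ (All.map (px ∷_) (All-subsets pxs)))

count-subsets-∷ : {A : Set} {P : List A → Set} (P? : Decidable P) (x : A) (xs : List A) →
  count P? (subsets (x ∷ xs)) ≡ count P? (subsets xs) + count (P? ∘ (x ∷_)) (subsets xs)
count-subsets-∷ P? x xs = trans (count-++ P? (subsets xs) (map (x ∷_) (subsets xs)))
                                (cong (_+_ (count P? (subsets xs))) (count-map P? (x ∷_) (subsets xs)))

length-subsets : {A : Set} (xs : List A) → length (subsets xs) ≡ 2 ^ length xs
length-subsets []       = refl
length-subsets (x ∷ xs) = begin
  length (subsets xs ++ map (x ∷_) (subsets xs))          ≡⟨ length-++ (subsets xs) ⟩
  length (subsets xs) + length (map (x ∷_) (subsets xs))  ≡⟨ cong (_+_ (length (subsets xs))) (length-map (x ∷_) (subsets xs)) ⟩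
  length (subsets xs) + length (subsets xs)               ≡⟨ cong₂ _+_ (length-subsets xs) (length-subsets xs) ⟩
  2 ^ length xs + 2 ^ length xs                           ≡⟨ cong (_+_ (2 ^ length xs)) (+-identityʳ _) ⟨
  2 ^ suc (length xs)                                     ∎

nonEmpty? : {A : Set} → Decidable (λ (X : List A) → 0 < length X)
nonEmpty? X = 0 <? length X

count-nonEmpty-subsets : {A : Set} (xs : List A) → suc (count nonEmpty? (subsets xs)) ≡ 2 ^ length xs
count-nonEmpty-subsets []       = refl
count-nonEmpty-subsets (x ∷ xs) = begin
  suc (count nonEmpty? (subsets (x ∷ xs)))
    ≡⟨ cong suc (count-subsets-∷ nonEmpty? x xs) ⟩
  suc (count nonEmpty? (subsets xs)) + count (nonEmpty? ∘ (x ∷_)) (subsets xs)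
    ≡⟨ cong₂ _+_ (count-nonEmpty-subsets xs) (count-all (nonEmpty? ∘ (x ∷_)) (All.universal (λ _ → s≤s z≤n) (subsets xs))) ⟩
  2 ^ length xs + length (subsets xs)
    ≡⟨ cong (_+_ (2 ^ length xs)) (trans (length-subsets xs) (sym (+-identityʳ _))) ⟩
  2 ^ suc (length xs)
    ∎

count-subsets-ofLength : {A : Set} (k : ℕ) (xs : List A) →
                         count (λ X → length X ≟ k) (subsets xs) ≡ length xs C k
count-subsets-ofLength zero    []       = refl
count-subsets-ofLength (suc k) []       = refl
count-subsets-ofLength zero    (x ∷ xs) = begin
  count (λ X → length X ≟ 0) (subsets (x ∷ xs))
    ≡⟨ count-subsets-∷ (λ X → length X ≟ 0) x xs ⟩
  count (λ X → length X ≟ 0) (subsets xs) + count (λ X → suc (length X) ≟ 0) (subsets xs)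
    ≡⟨ cong₂ _+_ (count-subsets-ofLength 0 xs) (count-none (λ X → suc (length X) ≟ 0) (All.universal (λ _ ()) (subsets xs))) ⟩
  length xs C 0 + 0
    ∎
count-subsets-ofLength (suc k) (x ∷ xs) = begin
  count (λ X → length X ≟ suc k) (subsets (x ∷ xs))
    ≡⟨ count-subsets-∷ (λ X → length X ≟ suc k) x xs ⟩
  count (λ X → length X ≟ suc k) (subsets xs) + count (λ X → suc (length X) ≟ suc k) (subsets xs)
    ≡⟨ cong (_+_ (count (λ X → length X ≟ suc k) (subsets xs)))
            (count-≐ (λ X → suc (length X) ≟ suc k) (λ X → length X ≟ k) (suc-injective , cong suc) (subsets xs)) ⟩
  count (λ X → length X ≟ suc k) (subsets xs) + count (λ X → length X ≟ k) (subsets xs)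
    ≡⟨ cong₂ _+_ (count-subsets-ofLength (suc k) xs) (count-subsets-ofLength k xs) ⟩
  length xs C suc k + length xs C k
    ≡⟨ +-comm (length xs C suc k) (length xs C k) ⟩
  length xs C k + length xs C suc k
    ≡⟨ nCk+nC[k+1]≡[n+1]C[k+1] (length xs) k ⟩
  suc (length xs) C suc k
    ∎

count-subsets-∣gcd : {Q : List ℕ → Set} (Q? : Decidable Q) (d : ℕ) (A : List ℕ) →
  count (λ X → d ∣? gcdL X ×-dec Q? X) (subsets A) ≡ count Q? (subsets (filter (d ∣?_) A))
count-subsets-∣gcd Q? d [] =
  trans (count-∷ (λ X → d ∣? gcdL X ×-dec Q? X) [] [])
        (trans (cong (λ c → c + 0) (𝟙-⇔ (d ∣? 0 ×-dec Q? []) (Q? []) proj₂ (λ q → d ∣0 , q)))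
               (sym (count-∷ Q? [] [])))
count-subsets-∣gcd {Q} Q? d (x ∷ xs) with d ∣? x
... | yes d∣x = begin
  count P? (subsets (x ∷ xs))
    ≡⟨ count-subsets-∷ P? x xs ⟩
  count P? (subsets xs) + count (λ X → d ∣? gcd x (gcdL X) ×-dec Q? (x ∷ X)) (subsets xs)
    ≡⟨ cong (_+_ (count P? (subsets xs)))
            (count-≐ _ (λ X → d ∣? gcdL X ×-dec Q? (x ∷ X))
                     ((λ (d∣g , q) → ∣-trans d∣g (gcd[m,n]∣n x _) , q) , (λ (d∣g , q) → gcd-greatest d∣x d∣g , q))
                     (subsets xs)) ⟩
  count P? (subsets xs) + count (λ X → d ∣? gcdL X ×-dec Q? (x ∷ X)) (subsets xs)
    ≡⟨ cong₂ _+_ (count-subsets-∣gcd Q? d xs) (count-subsets-∣gcd (Q? ∘ (x ∷_)) d xs) ⟩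
  count Q? (subsets F) + count (Q? ∘ (x ∷_)) (subsets F)
    ≡⟨ count-subsets-∷ Q? x F ⟨
  count Q? (subsets (x ∷ F))  ∎
  where
  P? = λ X → d ∣? gcdL X ×-dec Q? X
  F  = filter (d ∣?_) xs
... | no d∤x = begin
  count P? (subsets (x ∷ xs))
    ≡⟨ count-subsets-∷ P? x xs ⟩
  count P? (subsets xs) + count (P? ∘ (x ∷_)) (subsets xs)
    ≡⟨ cong₂ _+_ (count-subsets-∣gcd Q? d xs) (count-none (P? ∘ (x ∷_)) (All.universal d∤ (subsets xs))) ⟩
  count Q? (subsets (filter (d ∣?_) xs)) + 0
    ≡⟨ +-identityʳ _ ⟩
  count Q? (subsets (filter (d ∣?_) xs))  ∎
  where
  P? = λ X → d ∣? gcdL X ×-dec Q? X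
  d∤ : ∀ X → ¬ (d ∣ gcd x (gcdL X) × Q (x ∷ X))
  d∤ X (d∣g , _) = d∤x (∣-trans d∣g (gcd[m,n]∣m x (gcdL X)))

-- Möbius inversion over subsets

InRange : ℕ → ℕ → ℕ → Set
InRange l m x = l ≤ x × x ≤ m

Σμ-gcd : ∀ N {x xs} → All (InRange 1 N) (x ∷ xs) →
  + 𝟙 (gcdL (x ∷ xs) ≟ 1) ≡ sumFrom1 N (λ d → μ d ℤ.* + 𝟙 (d ∣? gcdL (x ∷ xs)))
Σμ-gcd N {x@(suc _)} {xs} ((_ , x≤N) ∷ _) =
  sym (Σμ-divisors-upTo N {{g≢0}} (≤-trans (∣⇒≤ (gcd[m,n]∣m x (gcdL xs))) x≤N))
  where
  g≢0 : NonZero (gcd x (gcdL xs))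
  g≢0 = ≢-nonZero (gcd[m,n]≢0 x (gcdL xs) (inj₁ λ ()))

module _ {Q : List ℕ → Set} (Q? : Decidable Q) (¬Q[] : ¬ Q []) (N : ℕ) where

  𝟙-gcd≡1 : ∀ X → All (InRange 1 N) X →
    + 𝟙 (gcdL X ≟ 1 ×-dec Q? X) ≡ sumFrom1 N (λ d → μ d ℤ.* + 𝟙 (d ∣? gcdL X ×-dec Q? X))
  𝟙-gcd≡1 X X⊆[1,N] with Q? X
  ... | no ¬q = begin
    + 𝟙 (gcdL X ≟ 1 ×-dec no ¬q)                              ≡⟨ cong +_ (𝟙-×-noʳ (gcdL X ≟ 1) ¬q) ⟩
    0ℤ                                                         ≡⟨ sumFrom1-zero N ⟨
    sumFrom1 N (λ _ → 0ℤ)                                      ≡⟨ sumFrom1-cong N (λ d → vanish d) ⟨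
    sumFrom1 N (λ d → μ d ℤ.* + 𝟙 (d ∣? gcdL X ×-dec no ¬q))   ∎
    where
    vanish : ∀ d → μ d ℤ.* + 𝟙 (d ∣? gcdL X ×-dec no ¬q) ≡ 0ℤ
    vanish d = trans (cong (λ c → μ d ℤ.* + c) (𝟙-×-noʳ (d ∣? gcdL X) ¬q)) (ℤP.*-zeroʳ (μ d))
  ... | yes q with X
  ...   | []     = contradiction q ¬Q[]
  ...   | x ∷ xs = begin
    + 𝟙 (gcdL (x ∷ xs) ≟ 1 ×-dec yes q)
      ≡⟨ cong +_ (𝟙-×-yesʳ (gcdL (x ∷ xs) ≟ 1) q) ⟩
    + 𝟙 (gcdL (x ∷ xs) ≟ 1)
      ≡⟨ Σμ-gcd N X⊆[1,N] ⟩
    sumFrom1 N (λ d → μ d ℤ.* + 𝟙 (d ∣? gcdL (x ∷ xs)))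
      ≡⟨ sumFrom1-cong N (λ d → cong (λ c → μ d ℤ.* + c) (𝟙-×-yesʳ (d ∣? gcdL (x ∷ xs)) q)) ⟨
    sumFrom1 N (λ d → μ d ℤ.* + 𝟙 (d ∣? gcdL (x ∷ xs) ×-dec yes q))
      ∎

  count-gcd≡1 : ∀ Xs → All (All (InRange 1 N)) Xs →
    + count (λ X → gcdL X ≟ 1 ×-dec Q? X) Xs
      ≡ sumFrom1 N (λ d → μ d ℤ.* + count (λ X → d ∣? gcdL X ×-dec Q? X) Xs)
  count-gcd≡1 [] [] = sym (trans (sumFrom1-cong N (λ d → ℤP.*-zeroʳ (μ d))) (sumFrom1-zero N))
  count-gcd≡1 (X ∷ Xs) (X⊆[1,N] ∷ Xs⊆[1,N]) = begin
    + count G? (X ∷ Xs)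
      ≡⟨ cong +_ (count-∷ G? X Xs) ⟩
    + (𝟙 (G? X) + count G? Xs)
      ≡⟨ ℤP.pos-+ (𝟙 (G? X)) (count G? Xs) ⟩
    + 𝟙 (G? X) ℤ.+ + count G? Xs
      ≡⟨ cong₂ ℤ._+_ (𝟙-gcd≡1 X X⊆[1,N]) (count-gcd≡1 Xs Xs⊆[1,N]) ⟩
    sumFrom1 N (λ d → μ d ℤ.* + 𝟙 (D? d X)) ℤ.+ sumFrom1 N (λ d → μ d ℤ.* + count (D? d) Xs)
      ≡⟨ sumFrom1-+ N _ _ ⟨
    sumFrom1 N (λ d → μ d ℤ.* + 𝟙 (D? d X) ℤ.+ μ d ℤ.* + count (D? d) Xs)
      ≡⟨ sumFrom1-cong N (λ d → μ-count-∷ d) ⟩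
    sumFrom1 N (λ d → μ d ℤ.* + count (D? d) (X ∷ Xs)) ∎
    where
    G? = λ X → gcdL X ≟ 1 ×-dec Q? X
    D? = λ d X → d ∣? gcdL X ×-dec Q? X
    μ-count-∷ : ∀ d → μ d ℤ.* + 𝟙 (D? d X) ℤ.+ μ d ℤ.* + count (D? d) Xs
                    ≡ μ d ℤ.* + count (D? d) (X ∷ Xs)
    μ-count-∷ d = begin
      μ d ℤ.* + 𝟙 (D? d X) ℤ.+ μ d ℤ.* + count (D? d) Xs  ≡⟨ ℤP.*-distribˡ-+ (μ d) _ _ ⟨
      μ d ℤ.* (+ 𝟙 (D? d X) ℤ.+ + count (D? d) Xs)        ≡⟨ cong (μ d ℤ.*_) (ℤP.pos-+ (𝟙 (D? d X)) (count (D? d) Xs)) ⟨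
      μ d ℤ.* + (𝟙 (D? d X) + count (D? d) Xs)            ≡⟨ cong (λ c → μ d ℤ.* + c) (count-∷ (D? d) X Xs) ⟨
      μ d ℤ.* + count (D? d) (X ∷ Xs)                     ∎

  count-subsets-gcd≡1 : ∀ A → All (InRange 1 N) A →
    + count (λ X → gcdL X ≟ 1 ×-dec Q? X) (subsets A)
      ≡ sumFrom1 N (λ d → μ d ℤ.* + count Q? (subsets (filter (d ∣?_) A)))
  count-subsets-gcd≡1 A A⊆[1,N] =
    trans (count-gcd≡1 (subsets A) (All-subsets A⊆[1,N]))
          (sumFrom1-cong N (λ d → cong (λ c → μ d ℤ.* + c) (count-subsets-∣gcd Q? d A)))

module _ {N : ℕ} {A : List ℕ} (A⊆[1,N] : All (InRange 1 N) A) where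

  f≡Σμ : + f A ≡ sumFrom1 N (λ d → μ d ℤ.* (+ (2 ^ count (d ∣?_) A) ℤ.- + 1))
  f≡Σμ = begin
    + f A
      ≡⟨ cong +_ (count-≐ (λ X → gcdL X ≟ 1) (λ X → gcdL X ≟ 1 ×-dec nonEmpty? X) gcd≡1⇒nonEmpty (subsets A)) ⟩
    + count (λ X → gcdL X ≟ 1 ×-dec nonEmpty? X) (subsets A)
      ≡⟨ count-subsets-gcd≡1 nonEmpty? (λ ()) N A A⊆[1,N] ⟩
    sumFrom1 N (λ d → μ d ℤ.* + count nonEmpty? (subsets (filter (d ∣?_) A)))
      ≡⟨ sumFrom1-cong N (λ d → cong (μ d ℤ.*_) (nonEmpty-count (filter (d ∣?_) A))) ⟩
    sumFrom1 N (λ d → μ d ℤ.* (+ (2 ^ count (d ∣?_) A) ℤ.- + 1)) ∎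
    where
    gcd≡1⇒nonEmpty : (λ X → gcdL X ≡ 1) ≐ (λ X → gcdL X ≡ 1 × 0 < length X)
    gcd≡1⇒nonEmpty = (λ { {_ ∷ _} g≡1 → g≡1 , s≤s z≤n }) , proj₁
    nonEmpty-count : (B : List ℕ) → + count nonEmpty? (subsets B) ≡ + (2 ^ length B) ℤ.- + 1
    nonEmpty-count B = trans (+1-1 (+ count nonEmpty? (subsets B)))
                             (cong (λ c → + c ℤ.- + 1) (count-nonEmpty-subsets B))
      where
      +1-1 : ∀ z → z ≡ (+ 1 ℤ.+ z) ℤ.- + 1
      +1-1 = solve-∀

  fk≡Σμ : ∀ {k} → 1 ≤ k → + fk k A ≡ sumFrom1 N (λ d → μ d ℤ.* + (count (d ∣?_) A C k))
  fk≡Σμ {k} 1≤k =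
    trans (count-subsets-gcd≡1 (λ X → length X ≟ k) (λ 0≡k → <⇒≢ 1≤k 0≡k) N A A⊆[1,N])
          (sumFrom1-cong N (λ d → cong (λ c → μ d ℤ.* + c) (count-subsets-ofLength k (filter (d ∣?_) A))))

-- Multiples of d in an interval

suc-/ : ∀ m d .{{_ : NonZero d}} → suc m / d ≡ m / d + 𝟙 (d ∣? suc m)
suc-/ m d with m≤n⇒m<n∨m≡n (m%n<n m d)
... | inj₁ 1+r<d = begin
  suc m / d                ≡⟨ /-congˡ 1+m≡1+r+qd ⟩
  (suc r + q * d) / d      ≡⟨ +-distrib-/-∣ʳ (suc r) (n∣m*n q) ⟩
  suc r / d + q * d / d    ≡⟨ cong₂ _+_ (m<n⇒m/n≡0 1+r<d) (m*n/n≡m q d) ⟩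
  q                        ≡⟨ +-identityʳ q ⟨
  q + 0                    ≡⟨ cong (_+_ q) (𝟙-no (d ∣? suc m) d∤1+m) ⟨
  q + 𝟙 (d ∣? suc m)       ∎
  where
  q = m / d
  r = m % d
  1+m≡1+r+qd : suc m ≡ suc r + q * d
  1+m≡1+r+qd = cong suc (m≡m%n+[m/n]*n m d)
  d∤1+m : ¬ d ∣ suc m
  d∤1+m d∣1+m = 0≢1+n (begin
    0                        ≡⟨ n∣m⇒m%n≡0 (suc m) d d∣1+m ⟨
    suc m % d                ≡⟨ %-congˡ 1+m≡1+r+qd ⟩
    (suc r + q * d) % d      ≡⟨ [m+kn]%n≡m%n (suc r) q d ⟩
    suc r % d                ≡⟨ m<n⇒m%n≡m 1+r<d ⟩
    suc r                    ∎)
... | inj₂ 1+r≡d = begin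
  suc m / d                ≡⟨ /-congˡ 1+m≡[1+q]d ⟩
  suc q * d / d            ≡⟨ m*n/n≡m (suc q) d ⟩
  suc q                    ≡⟨ +-comm 1 q ⟩
  q + 1                    ≡⟨ cong (_+_ q) (𝟙-yes (d ∣? suc m) (divides (suc q) 1+m≡[1+q]d)) ⟨
  q + 𝟙 (d ∣? suc m)       ∎
  where
  q = m / d
  1+m≡[1+q]d : suc m ≡ suc q * d
  1+m≡[1+q]d = trans (cong suc (m≡m%n+[m/n]*n m d)) (cong (λ t → t + q * d) 1+r≡d)

count-∣-range : ∀ d .{{_ : NonZero d}} {a m} → a ≤ m → count (d ∣?_) (range (suc a) m) + a / d ≡ m / d
count-∣-range d {a} {m} a≤m = begin
  count (d ∣?_) (range (suc a) m) + a / d              ≡⟨ cong (λ c → c + a / d) (count-map (d ∣?_) (_+_ (suc a)) (upTo (m ∸ a))) ⟩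
  count (λ i → d ∣? suc a + i) (upTo (m ∸ a)) + a / d  ≡⟨ count-from (m ∸ a) ⟩
  (a + (m ∸ a)) / d                                    ≡⟨ /-congˡ (m+[n∸m]≡n a≤m) ⟩
  m / d                                                ∎
  where
  c : ℕ → ℕ
  c j = count (λ i → d ∣? suc a + i) (upTo j)
  count-from : ∀ j → c j + a / d ≡ (a + j) / d
  count-from zero    = /-congˡ (sym (+-identityʳ a))
  count-from (suc j) = begin
    c (suc j) + a / d                          ≡⟨ cong (λ t → t + a / d) (count-applyUpTo-suc (λ i → d ∣? suc a + i) id j) ⟩
    c j + 𝟙 (d ∣? suc (a + j)) + a / d         ≡⟨ +-comm-middle (c j) (𝟙 (d ∣? suc (a + j))) (a / d) ⟩
    c j + a / d + 𝟙 (d ∣? suc (a + j))         ≡⟨ cong (λ t → t + 𝟙 (d ∣? suc (a + j))) (count-from j) ⟩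
    (a + j) / d + 𝟙 (d ∣? suc (a + j))         ≡⟨ suc-/ (a + j) d ⟨
    suc (a + j) / d                            ≡⟨ /-congˡ (+-suc a j) ⟨
    (a + suc j) / d                            ∎
    where
    +-comm-middle : ∀ x y z → x + y + z ≡ x + z + y
    +-comm-middle = ℕ-Solver.solve-∀

InRange-mono : ∀ {l l′ m m′ x} → l′ ≤ l → m ≤ m′ → InRange l m x → InRange l′ m′ x
InRange-mono l′≤l m≤m′ (l≤x , x≤m) = ≤-trans l′≤l l≤x , ≤-trans x≤m m≤m′

range-InRange : ∀ l m → All (InRange l m) (range l m)
range-InRange l m = map⁺ (All.map (λ {i} i<k → m≤m+n l i , l+i≤m i<k) (all-upTo (suc m ∸ l)))
  where
  l+i≤m : ∀ {i} → i < suc m ∸ l → l + i ≤ m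
  l+i≤m {i} i<k =
    ≤-pred (subst (_≤ suc m) (trans (+-comm (suc i) l) (+-suc l i)) (m≤o∸n⇒m+n≤o (suc i) (<⇒≤ l<1+m) i<k))
    where
    l<1+m : l < suc m
    l<1+m = m∸n≢0⇒n<m (λ k≡0 → n≮0 (subst (i <_) k≡0 i<k))

count-∣-ranges≡expo : ∀ d .{{_ : NonZero d}} {a₁ m₁ a₂ m₂} → a₁ ≤ m₁ → a₂ ≤ m₂ →
  count (d ∣?_) (range (suc a₁) m₁ ++ range (suc a₂) m₂) ≡ expo (suc a₁) m₁ (suc a₂) m₂ d
count-∣-ranges≡expo d@(suc _) {a₁} {m₁} {a₂} {m₂} a₁≤m₁ a₂≤m₂ = begin
  count (d ∣?_) (range (suc a₁) m₁ ++ range (suc a₂) m₂)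
    ≡⟨ count-++ (d ∣?_) (range (suc a₁) m₁) (range (suc a₂) m₂) ⟩
  c₁ + c₂
    ≡⟨ +-∸-cancel c₁ c₂ (a₁ / d) (a₂ / d) ⟩
  (c₁ + a₁ / d + (c₂ + a₂ / d)) ∸ a₁ / d ∸ a₂ / d
    ≡⟨ cong₂ (λ u v → (u + v) ∸ a₁ / d ∸ a₂ / d) (count-∣-range d a₁≤m₁) (count-∣-range d a₂≤m₂) ⟩
  (m₁ / d + m₂ / d) ∸ a₁ / d ∸ a₂ / d
    ∎
  where
  c₁ = count (d ∣?_) (range (suc a₁) m₁)
  c₂ = count (d ∣?_) (range (suc a₂) m₂)
  +-∸-cancel : ∀ x y u v → x + y ≡ (x + u + (y + v)) ∸ u ∸ v
  +-∸-cancel x y u v = sym (begin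
    (x + u + (y + v)) ∸ u ∸ v  ≡⟨ cong (λ t → t ∸ u ∸ v) (rearrange x y u v) ⟩
    (x + y + v + u) ∸ u ∸ v    ≡⟨ cong (_∸ v) (m+n∸n≡m (x + y + v) u) ⟩
    (x + y + v) ∸ v            ≡⟨ m+n∸n≡m (x + y) v ⟩
    x + y                      ∎)
    where
    rearrange : ∀ x y u v → x + u + (y + v) ≡ x + y + v + u
    rearrange = ℕ-Solver.solve-∀

theorem3 : (l1 m1 l2 m2 k : ℕ) → 1 ≤ l1 → l1 ≤ m1 → m1 < l2 → l2 ≤ m2 → 1 ≤ k →
    ((+ f (range l1 m1 ++ range l2 m2))
    ≡ sumFrom1 m2 (λ d → μ d ℤ.* (+ (2 ^ expo l1 m1 l2 m2 d) ℤ.- + 1)))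
    × ((+ fk k (range l1 m1 ++ range l2 m2))
    ≡ sumFrom1 m2 (λ d → μ d ℤ.* + (expo l1 m1 l2 m2 d C k)))
theorem3 zero    _  _       _  _ () _ _ _ _
theorem3 (suc _) _  zero    _  _ _ _ () _ _
theorem3 (suc a₁) m₁ (suc a₂) m₂ k _ l₁≤m₁ m₁<l₂ l₂≤m₂ 1≤k =
    trans (f≡Σμ A⊆[1,m₂]) (sumFrom1-cong m₂ (λ d → cong (λ c → μ d ℤ.* (+ (2 ^ c) ℤ.- + 1)) (count≡expo d)))
  , trans (fk≡Σμ A⊆[1,m₂] 1≤k) (sumFrom1-cong m₂ (λ d → cong (λ c → μ d ℤ.* + (c C k)) (count≡expo d)))
  where
  A : List ℕ
  A = range (suc a₁) m₁ ++ range (suc a₂) m₂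
  A⊆[1,m₂] : All (InRange 1 m₂) A
  A⊆[1,m₂] = ++⁺ (All.map (InRange-mono (s≤s z≤n) (<⇒≤ (<-≤-trans m₁<l₂ l₂≤m₂))) (range-InRange (suc a₁) m₁))
                 (All.map (InRange-mono (s≤s z≤n) ≤-refl) (range-InRange (suc a₂) m₂))
  count≡expo : ∀ d .{{_ : NonZero d}} → count (d ∣?_) A ≡ expo (suc a₁) m₁ (suc a₂) m₂ d
  count≡expo d = count-∣-ranges≡expo d (≤-trans (n≤1+n a₁) l₁≤m₁) (≤-trans (n≤1+n a₂) l₂≤m₂)
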